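{- For every integer $h\ge1$, let $t_{n,m,h}$ be the number of active growing binary trees of height $h$ with $n$ internal nodes and $m$ anchors, and let $S_h=\{(n,k)\in\mathbb{Z}_{>0}^2 : t_{n,2k,h}\neq0\}$. Then the cardinality of $S_h$ is $2^{h-2}(2^{h-1}-h+2)$.
   Context: Growing binary trees are plane (ordered) binary trees whose nodes are of three types: internal nodes, anchors (active leaves) and dead leaves. They are produced by the following growth process: at time $t=0$ the tree consists of a single anchor; at each time $t=1,2,\dots$, every anchor is simultaneously replaced either by a dead leaf or by an internal node with two anchors as children. A growing binary tree is any tree obtainable after finitely many steps of this process; it is active if it has at least one anchor. The height of a tree is the maximal distance from the root to a node. -}

module Defs where

open import Data.Nat using (ℕ; zero; suc; _+_; _*_; _⊔_; _<_; _≥_)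
open import Data.Product using (Σ; ∃; _×_; _,_)
open import Relation.Binary.PropositionalEquality using (_≡_)

data GTree : Set where
  anchor : GTree
  dead   : GTree
  node   : GTree → GTree → GTree

data Step : GTree → GTree → Set where
  anchor-dead : Step anchor dead
  anchor-grow : Step anchor (node anchor anchor)
  dead-stay   : Step dead dead
  node-step   : ∀ {l l′ r r′} → Step l l′ → Step r r′ → Step (node l r) (node l′ r′)

data Steps : ℕ → GTree → GTree → Set where
  done : ∀ {t} → Steps zero t t
  more : ∀ {k t t′ t″} → Step t t′ → Steps k t′ t″ → Steps (suc k) t t″

Growing : GTree → Set
Growing t = ∃ λ k → Steps k anchor t

internals : GTree → ℕ
internals anchor     = 0
internals dead       = 0
internals (node l r) = suc (internals l + internals r)

anchors : GTree → ℕ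
anchors anchor     = 1
anchors dead       = 0
anchors (node l r) = anchors l + anchors r

height : GTree → ℕ
height anchor     = 0
height dead       = 0
height (node l r) = suc (height l ⊔ height r)

Active : GTree → Set
Active t = anchors t ≥ 1

tNonzero : ℕ → ℕ → ℕ → Set
tNonzero n m h =
  Σ GTree λ t → Growing t × Active t × height t ≡ h × internals t ≡ n × anchors t ≡ m

InS : ℕ → ℕ × ℕ → Set
InS h (n , k) = 0 < n × 0 < k × tNonzero n (2 * k) h

{-# OPTIONS --safe #-}
module Submission where

-- An active tree grown in s steps has height s, and a tree grown in d + 1 steps is either a
-- dead leaf or a root over two trees grown in d steps; so S_(d+1) is read off the inductive
-- family Profile d of pairs (internal nodes, anchors / 2) of such trees.  For 1 ≤ k ≤ 2^d the
-- admissible n form the interval minInternals d k ≤ n < 2^d + k: the upper end counts all 2^d - 1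
-- nodes of depth < d plus the k parents of anchors, the lower end comes from stripping the bottom
-- layer (k parents of anchors need at least ⌈k/2⌉ parents), and every value in between is
-- reached by adding internal nodes one at a time.  Summing the interval lengths over k, the
-- recursion minInternals (d+1) k = minInternals d ⌈k/2⌉ + k pairs the columns 2j - 1 and 2j
-- and gives 2 ∑ₖ minInternals d k = 2·4^d + d·2^d, whence 2 |S_(d+1)| = 2^d (2^d + 1 - d).

open import Defs
open import Data.Nat using (ℕ; _+_; _*_; _∸_; _^_; _≥_)
open import Data.Product using (Σ; _×_)
open import Data.List using (List; length)
open import Data.List.Relation.Unary.Unique.Propositional using (Unique)
open import Data.List.Membership.Propositional using (_∈_)
open import Function.Bundles using (_⇔_)
open import Relation.Binary.PropositionalEquality using (_≡_)

open import Data.Nat using (zero; suc; _≤_; _<_; z≤n; s≤s; _⊓_; ⌊_/2⌋; ⌈_/2⌉)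
open import Data.Nat.Properties
open import Algebra.Properties.CommutativeSemigroup +-commutativeSemigroup using (interchange; x∙yz≈y∙xz)
open import Data.Nat.Tactic.RingSolver using (solve-∀)
open import Data.Product using (_,_; proj₁; ∃; ∃₂)
open import Data.Sum using (_⊎_; inj₁; inj₂)
open import Data.List using ([]; _++_; applyUpTo)
open import Data.List.Properties using (length-++; length-applyUpTo)
open import Data.List.Membership.Propositional.Properties
  using (∈-++⁻; ∈-++⁺ˡ; ∈-++⁺ʳ; ∈-applyUpTo⁺; ∈-applyUpTo⁻)
open import Data.List.Relation.Binary.Disjoint.Propositional using (Disjoint)
open import Data.List.Relation.Unary.AllPairs using ([])
import Data.List.Relation.Unary.Unique.Propositional.Properties as Unique
open import Function.Bundles using (mk⇔)
import Function.Properties.Equivalence as ⇔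
open import Relation.Binary.PropositionalEquality
  using (refl; sym; trans; cong; cong₂; subst; subst₂; module ≡-Reasoning)
open import Relation.Nullary using (yes; no; contradiction)

2^[1+d]≡2^d+2^d : ∀ d → 2 ^ suc d ≡ 2 ^ d + 2 ^ d
2^[1+d]≡2^d+2^d d = cong (2 ^ d +_) (+-identityʳ (2 ^ d))

2^[1+d]+[a+b]≡[2^d+a]+[2^d+b] : ∀ d a b → 2 ^ suc d + (a + b) ≡ (2 ^ d + a) + (2 ^ d + b)
2^[1+d]+[a+b]≡[2^d+a]+[2^d+b] d a b =
  trans (cong (_+ (a + b)) (2^[1+d]≡2^d+2^d d)) (interchange (2 ^ d) (2 ^ d) a b)

m≤n+o⇒split : ∀ {m} n o → m ≤ n + o → ∃₂ λ m₁ m₂ → m₁ + m₂ ≡ m × m₁ ≤ n × m₂ ≤ o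
m≤n+o⇒split {m} n o m≤n+o = n ⊓ m , m ∸ n , m⊓n+n∸m≡n n m , m⊓n≤m n m , m≤n+o⇒m∸n≤o m n m≤n+o

m+n>0⇒m>0∨n>0 : ∀ m {n} → 0 < m + n → 0 < m ⊎ 0 < n
m+n>0⇒m>0∨n>0 zero    0<n = inj₂ 0<n
m+n>0⇒m>0∨n>0 (suc m) _   = inj₁ (s≤s z≤n)

⌊2*n/2⌋≡n : ∀ n → ⌊ 2 * n /2⌋ ≡ n
⌊2*n/2⌋≡n n = trans (cong (λ m → ⌊ n + m /2⌋) (+-identityʳ n)) (sym (n≡⌊n+n/2⌋ n))

⌈2*n/2⌉≡n : ∀ n → ⌈ 2 * n /2⌉ ≡ n
⌈2*n/2⌉≡n n = trans (cong (λ m → ⌈ n + m /2⌉) (+-identityʳ n)) (sym (n≡⌈n+n/2⌉ n))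

n≤2*m⇒⌈n/2⌉≤m : ∀ {n m} → n ≤ 2 * m → ⌈ n /2⌉ ≤ m
n≤2*m⇒⌈n/2⌉≤m {m = m} n≤2m = subst (_ ≤_) (⌈2*n/2⌉≡n m) (⌈n/2⌉-mono n≤2m)

n≤2*⌈n/2⌉ : ∀ n → n ≤ 2 * ⌈ n /2⌉
n≤2*⌈n/2⌉ n = begin
  n                     ≡⟨ sym (⌊n/2⌋+⌈n/2⌉≡n n) ⟩
  ⌊ n /2⌋ + ⌈ n /2⌉     ≤⟨ +-monoˡ-≤ ⌈ n /2⌉ (⌊n/2⌋≤⌈n/2⌉ n) ⟩
  ⌈ n /2⌉ + ⌈ n /2⌉     ≡⟨ cong (⌈ n /2⌉ +_) (sym (+-identityʳ ⌈ n /2⌉)) ⟩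
  2 * ⌈ n /2⌉           ∎
  where open ≤-Reasoning

∑₁ : ℕ → (ℕ → ℕ) → ℕ
∑₁ zero    f = 0
∑₁ (suc n) f = ∑₁ n f + f (suc n)

∑₁-cong : ∀ n {f g : ℕ → ℕ} → (∀ {k} → k ≤ n → f k ≡ g k) → ∑₁ n f ≡ ∑₁ n g
∑₁-cong zero    f≗g = refl
∑₁-cong (suc n) f≗g = cong₂ _+_ (∑₁-cong n (λ k≤n → f≗g (m≤n⇒m≤1+n k≤n))) (f≗g ≤-refl)

∑₁-+ : ∀ n (f g : ℕ → ℕ) → ∑₁ n (λ k → f k + g k) ≡ ∑₁ n f + ∑₁ n g
∑₁-+ zero    f g = refl
∑₁-+ (suc n) f g = trans (cong (_+ (f (suc n) + g (suc n))) (∑₁-+ n f g))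
                         (interchange (∑₁ n f) (∑₁ n g) (f (suc n)) (g (suc n)))

∑₁-const : ∀ n c → ∑₁ n (λ _ → c) ≡ n * c
∑₁-const zero    c = refl
∑₁-const (suc n) c = trans (cong (_+ c) (∑₁-const n c)) (+-comm (n * c) c)

∑₁-id : ∀ n → 2 * ∑₁ n (λ k → k) ≡ n * suc n
∑₁-id zero    = refl
∑₁-id (suc n) = begin
  2 * (∑₁ n (λ k → k) + suc n)      ≡⟨ *-distribˡ-+ 2 (∑₁ n (λ k → k)) (suc n) ⟩
  2 * ∑₁ n (λ k → k) + 2 * suc n    ≡⟨ cong (_+ 2 * suc n) (∑₁-id n) ⟩
  n * suc n + 2 * suc n             ≡⟨ sym (*-distribʳ-+ (suc n) n 2) ⟩
  (n + 2) * suc n                   ≡⟨ *-comm (n + 2) (suc n) ⟩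
  suc n * (n + 2)                   ≡⟨ cong (suc n *_) (+-comm n 2) ⟩
  suc n * suc (suc n)               ∎
  where open ≡-Reasoning

∑₁-⌈/2⌉ : ∀ (f : ℕ → ℕ) n → ∑₁ (2 * n) (λ k → f ⌈ k /2⌉) ≡ 2 * ∑₁ n f
∑₁-⌈/2⌉ f zero    = refl
∑₁-⌈/2⌉ f (suc n) = begin
  ∑₁ (2 * suc n) g
    ≡⟨ cong (λ m → ∑₁ m g) (*-suc 2 n) ⟩
  ∑₁ (2 * n) g + f (suc ⌊ 2 * n /2⌋) + f (suc ⌈ 2 * n /2⌉)
    ≡⟨ cong₂ (λ x y → x + f (suc y) + f (suc ⌈ 2 * n /2⌉)) (∑₁-⌈/2⌉ f n) (⌊2*n/2⌋≡n n) ⟩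
  2 * ∑₁ n f + f (suc n) + f (suc ⌈ 2 * n /2⌉)
    ≡⟨ cong (λ y → 2 * ∑₁ n f + f (suc n) + f (suc y)) (⌈2*n/2⌉≡n n) ⟩
  2 * ∑₁ n f + f (suc n) + f (suc n)
    ≡⟨ +-assoc (2 * ∑₁ n f) (f (suc n)) (f (suc n)) ⟩
  2 * ∑₁ n f + (f (suc n) + f (suc n))
    ≡⟨ cong (λ y → 2 * ∑₁ n f + (f (suc n) + y)) (sym (+-identityʳ (f (suc n)))) ⟩
  2 * ∑₁ n f + 2 * f (suc n)
    ≡⟨ sym (*-distribˡ-+ 2 (∑₁ n f) (f (suc n))) ⟩
  2 * ∑₁ (suc n) f ∎
  where
  open ≡-Reasoning
  g : ℕ → ℕ
  g k = f ⌈ k /2⌉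

column : ℕ → ℕ → ℕ → List (ℕ × ℕ)
column k a b = applyUpTo (λ i → i + a , k) (b ∸ a)

∈-column⁻ : ∀ {n k′} k a b → (n , k′) ∈ column k a b → k′ ≡ k × a ≤ n × n < b
∈-column⁻ k a b n∈ with ∈-applyUpTo⁻ (λ i → i + a , k) n∈
... | i , i<b∸a , refl = refl , m≤n+m a i , m≤o∸n⇒m+n≤o (suc i) a≤b i<b∸a
  where
  a≤b : a ≤ b
  a≤b = <⇒≤ (m∸n≢0⇒n<m (m<n⇒n≢0 i<b∸a))

∈-column⁺ : ∀ {n} k {a b} → a ≤ n → n < b → (n , k) ∈ column k a b
∈-column⁺ k {a} {b} a≤n n<b =
  subst (λ m → (m , k) ∈ column k a b) (m∸n+n≡m a≤n)
        (∈-applyUpTo⁺ (λ i → i + a , k) (∸-monoˡ-< n<b a≤n))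

column-unique : ∀ k a b → Unique (column k a b)
column-unique k a b = Unique.applyUpTo⁺₁ _ (b ∸ a)
  (λ i<j _ eq → <⇒≢ i<j (+-cancelʳ-≡ a _ _ (cong proj₁ eq)))

region : (ℕ → ℕ) → (ℕ → ℕ) → ℕ → List (ℕ × ℕ)
region a b zero    = []
region a b (suc c) = region a b c ++ column (suc c) (a (suc c)) (b (suc c))

InRegion : (ℕ → ℕ) → (ℕ → ℕ) → ℕ → ℕ × ℕ → Set
InRegion a b c (n , k) = 1 ≤ k × k ≤ c × a k ≤ n × n < b k

length-region : ∀ a b c → length (region a b c) ≡ ∑₁ c (λ k → b k ∸ a k)
length-region a b zero    = refl
length-region a b (suc c) = trans (length-++ (region a b c))
  (cong₂ _+_ (length-region a b c) (length-applyUpTo _ (b (suc c) ∸ a (suc c))))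

∈-region⁻ : ∀ a b c {p} → p ∈ region a b c → InRegion a b c p
∈-region⁻ a b (suc c) p∈ with ∈-++⁻ (region a b c) p∈
... | inj₁ p∈region with ∈-region⁻ a b c p∈region
...   | 1≤k , k≤c , a≤n , n<b = 1≤k , m≤n⇒m≤1+n k≤c , a≤n , n<b
∈-region⁻ a b (suc c) p∈ | inj₂ p∈column with ∈-column⁻ (suc c) _ _ p∈column
...   | refl , a≤n , n<b = s≤s z≤n , ≤-refl , a≤n , n<b

∈-region⁺ : ∀ a b c {p} → InRegion a b c p → p ∈ region a b c
∈-region⁺ a b zero    (s≤s _ , () , _)
∈-region⁺ a b (suc c) (1≤k , k≤1+c , a≤n , n<b) with m≤n⇒m<n∨m≡n k≤1+c
... | inj₁ (s≤s k≤c) = ∈-++⁺ˡ (∈-region⁺ a b c (1≤k , k≤c , a≤n , n<b))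
... | inj₂ refl      = ∈-++⁺ʳ (region a b c) (∈-column⁺ (suc c) a≤n n<b)

∈-region⇔ : ∀ a b c {p} → p ∈ region a b c ⇔ InRegion a b c p
∈-region⇔ a b c = mk⇔ (∈-region⁻ a b c) (∈-region⁺ a b c)

region-unique : ∀ a b c → Unique (region a b c)
region-unique a b zero    = []
region-unique a b (suc c) =
  Unique.++⁺ (region-unique a b c) (column-unique (suc c) (a (suc c)) (b (suc c))) disjoint
  where
  disjoint : Disjoint (region a b c) (column (suc c) (a (suc c)) (b (suc c)))
  disjoint (p∈region , p∈column) with ∈-region⁻ a b c p∈region | ∈-column⁻ (suc c) _ _ p∈column
  ... | _ , k≤c , _ | refl , _ = 1+n≰n k≤c

Steps-dead : ∀ d → Steps d dead dead
Steps-dead zero    = done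
Steps-dead (suc d) = more dead-stay (Steps-dead d)

Steps-node : ∀ {d a b l r} → Steps d a l → Steps d b r → Steps d (node a b) (node l r)
Steps-node done        done          = done
Steps-node (more s ss) (more s′ ss′) = more (node-step s s′) (Steps-node ss ss′)

Steps-dead⁻ : ∀ {d t} → Steps d dead t → t ≡ dead
Steps-dead⁻ done                = refl
Steps-dead⁻ (more dead-stay ss) = Steps-dead⁻ ss

data Children (d : ℕ) (a b : GTree) : GTree → Set where
  children : ∀ {l r} → Steps d a l → Steps d b r → Children d a b (node l r)

Steps-node⁻ : ∀ {d a b t} → Steps d (node a b) t → Children d a b t
Steps-node⁻ done = children done done
Steps-node⁻ (more (node-step s s′) ss) with Steps-node⁻ ss
... | children sl sr = children (more s sl) (more s′ sr)

firstStep : ∀ {d t} → Steps (suc d) anchor t → t ≡ dead ⊎ Children d anchor anchor t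
firstStep (more anchor-dead ss) = inj₁ (Steps-dead⁻ ss)
firstStep (more anchor-grow ss) = inj₂ (Steps-node⁻ ss)

height-≤ : ∀ {d t} → Steps d anchor t → height t ≤ d
height-≤ done = z≤n
height-≤ s@(more _ _) with firstStep s
... | inj₁ refl             = z≤n
... | inj₂ (children sl sr) = s≤s (⊔-lub (height-≤ sl) (height-≤ sr))

height-≥ : ∀ {d t} → Steps d anchor t → Active t → d ≤ height t
height-≥ done _ = z≤n
height-≥ s@(more _ _) active with firstStep s
height-≥ _ () | inj₁ refl
... | inj₂ (children {l} {r} sl sr) with m+n>0⇒m>0∨n>0 (anchors l) active
...   | inj₁ active-l = s≤s (≤-trans (height-≥ sl active-l) (m≤m⊔n (height l) (height r)))
...   | inj₂ active-r = s≤s (≤-trans (height-≥ sr active-r) (m≤n⊔m (height l) (height r)))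

height-active : ∀ {d t} → Steps d anchor t → Active t → height t ≡ d
height-active s active = ≤-antisym (height-≤ s) (height-≥ s active)

-- Profile d n k: some tree grown from an anchor in d + 1 steps has n internal nodes and 2 k anchors.
data Profile : ℕ → ℕ → ℕ → Set where
  dead : ∀ {d} → Profile d 0 0
  grow : Profile 0 1 1
  node : ∀ {d n₁ k₁ n₂ k₂} → Profile d n₁ k₁ → Profile d n₂ k₂ →
         Profile (suc d) (suc (n₁ + n₂)) (k₁ + k₂)

Steps⇒Profile : ∀ {d t} → Steps (suc d) anchor t → ∃ λ k → anchors t ≡ 2 * k × Profile d (internals t) k
Steps⇒Profile s with firstStep s
... | inj₁ refl = 0 , refl , dead
Steps⇒Profile {zero}  s | inj₂ (children done done) = 1 , refl , grow
Steps⇒Profile {suc d} s | inj₂ (children sl sr) with Steps⇒Profile sl | Steps⇒Profile sr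
... | k₁ , l≡2k₁ , p₁ | k₂ , r≡2k₂ , p₂ =
  k₁ + k₂ , trans (cong₂ _+_ l≡2k₁ r≡2k₂) (sym (*-distribˡ-+ 2 k₁ k₂)) , node p₁ p₂

Profile⇒Steps : ∀ {d n k} → Profile d n k →
                Σ GTree λ t → Steps (suc d) anchor t × internals t ≡ n × anchors t ≡ 2 * k
Profile⇒Steps {d} dead = dead , more anchor-dead (Steps-dead d) , refl , refl
Profile⇒Steps grow     = node anchor anchor , more anchor-grow done , refl , refl
Profile⇒Steps (node {k₁ = k₁} {k₂ = k₂} p₁ p₂) with Profile⇒Steps p₁ | Profile⇒Steps p₂
... | l , sl , refl , l≡2k₁ | r , sr , refl , r≡2k₂ =
  node l r , more anchor-grow (Steps-node sl sr) , refl ,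
  trans (cong₂ _+_ l≡2k₁ r≡2k₂) (sym (*-distribˡ-+ 2 k₁ k₂))

Profile⇒k≤2^d : ∀ {d n k} → Profile d n k → k ≤ 2 ^ d
Profile⇒k≤2^d dead = z≤n
Profile⇒k≤2^d grow = ≤-refl
Profile⇒k≤2^d (node {d} p₁ p₂) =
  ≤-trans (+-mono-≤ (Profile⇒k≤2^d p₁) (Profile⇒k≤2^d p₂)) (≤-reflexive (sym (2^[1+d]≡2^d+2^d d)))

Profile⇒n<2^d+k : ∀ {d n k} → Profile d n k → n < 2 ^ d + k
Profile⇒n<2^d+k {d} dead = subst (0 <_) (sym (+-identityʳ (2 ^ d))) (m^n>0 2 d)
Profile⇒n<2^d+k grow     = s≤s (s≤s z≤n)
Profile⇒n<2^d+k (node {d} {n₁} {k₁} {n₂} {k₂} p₁ p₂) =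
  subst₂ _≤_ (cong suc (+-suc n₁ n₂)) (sym (2^[1+d]+[a+b]≡[2^d+a]+[2^d+b] d k₁ k₂))
    (+-mono-≤ (Profile⇒n<2^d+k p₁) (Profile⇒n<2^d+k p₂))

Profile-extend : ∀ {d n k k′} → Profile d n k → k′ ≤ 2 * k → Profile (suc d) (n + k′) k′
Profile-extend dead z≤n             = dead
Profile-extend grow z≤n             = node dead dead
Profile-extend grow (s≤s z≤n)       = node dead grow
Profile-extend grow (s≤s (s≤s z≤n)) = node grow grow
Profile-extend {k′ = k′} (node {d} {n₁} {k₁} {n₂} {k₂} p₁ p₂) k′≤2k
  with m≤n+o⇒split (2 * k₁) (2 * k₂) (subst (k′ ≤_) (*-distribˡ-+ 2 k₁ k₂) k′≤2k)
... | k₁′ , k₂′ , refl , k₁′≤2k₁ , k₂′≤2k₂ =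
  subst (λ n → Profile (suc (suc d)) (suc n) (k₁′ + k₂′)) (interchange n₁ k₁′ n₂ k₂′)
    (node (Profile-extend p₁ k₁′≤2k₁) (Profile-extend p₂ k₂′≤2k₂))

Profile-trim : ∀ {d n k} → Profile (suc d) n k →
               ∃₂ λ n₀ k₀ → Profile d n₀ k₀ × k ≤ 2 * k₀ × n ≡ n₀ + k
Profile-trim dead                    = 0 , 0 , dead , z≤n , refl
Profile-trim {zero} (node dead dead) = 1 , 1 , grow , z≤n , refl
Profile-trim {zero} (node dead grow) = 1 , 1 , grow , s≤s z≤n , refl
Profile-trim {zero} (node grow dead) = 1 , 1 , grow , s≤s z≤n , refl
Profile-trim {zero} (node grow grow) = 1 , 1 , grow , s≤s (s≤s z≤n) , refl
Profile-trim {suc d} (node p₁ p₂) with Profile-trim p₁ | Profile-trim p₂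
... | n₁ , k₁ , q₁ , k₁′≤2k₁ , refl | n₂ , k₂ , q₂ , k₂′≤2k₂ , refl =
  suc (n₁ + n₂) , k₁ + k₂ , node q₁ q₂ ,
  ≤-trans (+-mono-≤ k₁′≤2k₁ k₂′≤2k₂) (≤-reflexive (sym (*-distribˡ-+ 2 k₁ k₂))) ,
  cong suc (interchange n₁ _ n₂ _)

Profile-suc : ∀ {d n k} → Profile d n k → suc n < 2 ^ d + k → Profile d (suc n) k
Profile-suc {zero}  dead (s≤s ())
Profile-suc {suc d} dead _ = node dead dead
Profile-suc grow (s≤s (s≤s ()))
Profile-suc (node {d} {n₁} {k₁} {n₂} {k₂} p₁ p₂) room
  with suc n₁ <? 2 ^ d + k₁ | suc n₂ <? 2 ^ d + k₂
... | yes room₁ | _         = node (Profile-suc p₁ room₁) p₂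
... | no _      | yes room₂ =
  subst (λ n → Profile (suc d) (suc n) (k₁ + k₂)) (+-suc n₁ n₂) (node p₁ (Profile-suc p₂ room₂))
... | no full₁  | no full₂  = contradiction (+-mono-≤ (≮⇒≥ full₁) (≮⇒≥ full₂)) (<⇒≱ room′)
  where
  room′ : suc n₁ + suc n₂ < (2 ^ d + k₁) + (2 ^ d + k₂)
  room′ = subst₂ _<_ (cong suc (sym (+-suc n₁ n₂))) (2^[1+d]+[a+b]≡[2^d+a]+[2^d+b] d k₁ k₂) room

Profile-upward : ∀ {d n n′ k} → Profile d n k → n ≤ n′ → n′ < 2 ^ d + k → Profile d n′ k
Profile-upward p n≤n′ n′<2^d+k with m≤n⇒m<n∨m≡n n≤n′
... | inj₂ refl       = p
... | inj₁ (s≤s n≤m) =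
  Profile-suc (Profile-upward p n≤m (<-trans (n<1+n _) n′<2^d+k)) n′<2^d+k

-- For 1 ≤ k ≤ 2 ^ d, the least number of internal nodes of a tree grown in d + 1 steps
-- with 2 k anchors: the k parents of the anchors need ⌈ k /2⌉ parents of their own, and so on.
minInternals : ℕ → ℕ → ℕ
minInternals zero    k = 1
minInternals (suc d) k = minInternals d ⌈ k /2⌉ + k

minInternals-mono : ∀ d {k k′} → k ≤ k′ → minInternals d k ≤ minInternals d k′
minInternals-mono zero    k≤k′ = ≤-refl
minInternals-mono (suc d) k≤k′ = +-mono-≤ (minInternals-mono d (⌈n/2⌉-mono k≤k′)) k≤k′

minInternals>0 : ∀ d k → 0 < minInternals d k
minInternals>0 zero    k = s≤s z≤n
minInternals>0 (suc d) k = ≤-trans (minInternals>0 d ⌈ k /2⌉) (m≤m+n _ k)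

minInternals≤2^d+k : ∀ d {k} → k ≤ 2 ^ d → minInternals d k ≤ 2 ^ d + k
minInternals≤2^d+k zero    k≤1 = s≤s z≤n
minInternals≤2^d+k (suc d) {k} k≤2^[1+d] = begin
  minInternals d ⌈ k /2⌉ + k  ≤⟨ +-monoˡ-≤ k (minInternals≤2^d+k d ⌈k/2⌉≤2^d) ⟩
  2 ^ d + ⌈ k /2⌉ + k         ≤⟨ +-monoˡ-≤ k (+-monoʳ-≤ (2 ^ d) ⌈k/2⌉≤2^d) ⟩
  2 ^ d + 2 ^ d + k           ≡⟨ cong (_+ k) (sym (2^[1+d]≡2^d+2^d d)) ⟩
  2 ^ suc d + k               ∎
  where
  open ≤-Reasoning
  ⌈k/2⌉≤2^d : ⌈ k /2⌉ ≤ 2 ^ d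
  ⌈k/2⌉≤2^d = n≤2*m⇒⌈n/2⌉≤m k≤2^[1+d]

Profile⇒minInternals≤n : ∀ {d n k} → Profile d n k → 0 < k → minInternals d k ≤ n
Profile⇒minInternals≤n dead ()
Profile⇒minInternals≤n grow _ = ≤-refl
Profile⇒minInternals≤n {suc d} p 0<k with Profile-trim p
... | n₀ , k₀ , p₀ , k≤2k₀ , refl =
  +-monoˡ-≤ _ (≤-trans (minInternals-mono d ⌈k/2⌉≤k₀)
                        (Profile⇒minInternals≤n p₀ (≤-trans (⌈n/2⌉-mono 0<k) ⌈k/2⌉≤k₀)))
  where ⌈k/2⌉≤k₀ = n≤2*m⇒⌈n/2⌉≤m k≤2k₀

Profile-minimal : ∀ d {k} → 0 < k → k ≤ 2 ^ d → Profile d (minInternals d k) k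
Profile-minimal zero    (s≤s z≤n) (s≤s z≤n) = grow
Profile-minimal (suc d) {k} 0<k k≤2^[1+d] =
  Profile-extend (Profile-minimal d (⌈n/2⌉-mono 0<k) (n≤2*m⇒⌈n/2⌉≤m k≤2^[1+d])) (n≤2*⌈n/2⌉ k)

InS⇒Profile : ∀ d {n k} → InS (suc d) (n , k) → Profile d n k
InS⇒Profile d {k = k} (_ , _ , t , (s , steps) , active , height≡1+d , refl , anchors≡2k)
  with refl ← trans (sym (height-active steps active)) height≡1+d
  with k′ , anchors≡2k′ , p ← Steps⇒Profile steps
  with refl ← *-cancelˡ-≡ k′ k 2 (trans (sym anchors≡2k′) anchors≡2k) = p

Profile⇒InS : ∀ {d n k} → 0 < k → Profile d n k → InS (suc d) (n , k)
Profile⇒InS {d} {k = k} 0<k p with Profile⇒Steps p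
... | t , steps , refl , anchors≡2k =
  ≤-trans (minInternals>0 d k) (Profile⇒minInternals≤n p 0<k) , 0<k ,
  t , (suc d , steps) , active , height-active steps active , refl , anchors≡2k
  where
  active : Active t
  active = subst (1 ≤_) (sym anchors≡2k) (≤-trans 0<k (m≤m+n k _))

InS⇔InRegion : ∀ d {p} → InS (suc d) p ⇔ InRegion (minInternals d) (2 ^ d +_) (2 ^ d) p
InS⇔InRegion d {n , k} = mk⇔ to from
  where
  to : InS (suc d) (n , k) → InRegion (minInternals d) (2 ^ d +_) (2 ^ d) (n , k)
  to n,k∈S@(_ , 0<k , _) =
    0<k , Profile⇒k≤2^d p , Profile⇒minInternals≤n p 0<k , Profile⇒n<2^d+k p
    where p = InS⇒Profile d n,k∈S
  from : InRegion (minInternals d) (2 ^ d +_) (2 ^ d) (n , k) → InS (suc d) (n , k)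
  from (0<k , k≤2^d , minInternals≤n , n<2^d+k) =
    Profile⇒InS 0<k (Profile-upward (Profile-minimal d 0<k k≤2^d) minInternals≤n n<2^d+k)

∑₁-minInternals : ∀ d → 2 * ∑₁ (2 ^ d) (minInternals d) ≡ 2 * (2 ^ d * 2 ^ d) + d * 2 ^ d
∑₁-minInternals zero    = refl
∑₁-minInternals (suc d) = begin
  2 * ∑₁ (2 * P) (λ k → minInternals d ⌈ k /2⌉ + k)
    ≡⟨ cong (2 *_) (∑₁-+ (2 * P) (λ k → minInternals d ⌈ k /2⌉) (λ k → k)) ⟩
  2 * (∑₁ (2 * P) (λ k → minInternals d ⌈ k /2⌉) + ∑₁ (2 * P) (λ k → k))
    ≡⟨ cong (λ x → 2 * (x + ∑₁ (2 * P) (λ k → k))) (∑₁-⌈/2⌉ (minInternals d) P) ⟩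
  2 * (2 * A + ∑₁ (2 * P) (λ k → k))
    ≡⟨ *-distribˡ-+ 2 (2 * A) (∑₁ (2 * P) (λ k → k)) ⟩
  2 * (2 * A) + 2 * ∑₁ (2 * P) (λ k → k)
    ≡⟨ cong₂ (λ x y → 2 * x + y) (∑₁-minInternals d) (∑₁-id (2 * P)) ⟩
  2 * (2 * (P * P) + d * P) + 2 * P * suc (2 * P)
    ≡⟨ arithmetic P d ⟩
  2 * (2 * P * (2 * P)) + suc d * (2 * P) ∎
  where
  open ≡-Reasoning
  P A : ℕ
  P = 2 ^ d
  A = ∑₁ P (minInternals d)
  arithmetic : ∀ P d → 2 * (2 * (P * P) + d * P) + 2 * P * suc (2 * P)
                       ≡ 2 * (2 * P * (2 * P)) + suc d * (2 * P)
  arithmetic = solve-∀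

∑₁-columnSizes : ∀ d → 2 * ∑₁ (2 ^ d) (λ k → 2 ^ d + k ∸ minInternals d k) ≡ 2 ^ d * (2 ^ d + 2 ∸ suc d)
∑₁-columnSizes d = begin
  2 * N                     ≡⟨ sym (m+n∸n≡m (2 * N) (d * P)) ⟩
  2 * N + d * P ∸ d * P     ≡⟨ cong₂ _∸_ 2N+dP≡P*[1+P] (*-comm d P) ⟩
  P * suc P ∸ P * d         ≡⟨ sym (*-distribˡ-∸ P (suc P) d) ⟩
  P * (suc P ∸ d)           ≡⟨ cong (λ m → P * (m ∸ suc d)) (+-comm 2 P) ⟩
  P * (P + 2 ∸ suc d)       ∎
  where
  open ≡-Reasoning
  P N A : ℕ
  P = 2 ^ d
  N = ∑₁ P (λ k → P + k ∸ minInternals d k)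
  A = ∑₁ P (minInternals d)
  N+A≡P*P+∑k : N + A ≡ P * P + ∑₁ P (λ k → k)
  N+A≡P*P+∑k = begin
    N + A                             ≡⟨ sym (∑₁-+ P (λ k → P + k ∸ minInternals d k) (minInternals d)) ⟩
    ∑₁ P (λ k → P + k ∸ minInternals d k + minInternals d k)
      ≡⟨ ∑₁-cong P (λ k≤P → m∸n+n≡m (minInternals≤2^d+k d k≤P)) ⟩
    ∑₁ P (λ k → P + k)                ≡⟨ ∑₁-+ P (λ _ → P) (λ k → k) ⟩
    ∑₁ P (λ _ → P) + ∑₁ P (λ k → k)   ≡⟨ cong (_+ ∑₁ P (λ k → k)) (∑₁-const P P) ⟩
    P * P + ∑₁ P (λ k → k)            ∎
  2N+dP≡P*[1+P] : 2 * N + d * P ≡ P * suc P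
  2N+dP≡P*[1+P] = +-cancelˡ-≡ (2 * (P * P)) _ _ (begin
    2 * (P * P) + (2 * N + d * P)     ≡⟨ x∙yz≈y∙xz (2 * (P * P)) (2 * N) (d * P) ⟩
    2 * N + (2 * (P * P) + d * P)     ≡⟨ cong (2 * N +_) (sym (∑₁-minInternals d)) ⟩
    2 * N + 2 * A                     ≡⟨ sym (*-distribˡ-+ 2 N A) ⟩
    2 * (N + A)                       ≡⟨ cong (2 *_) N+A≡P*P+∑k ⟩
    2 * (P * P + ∑₁ P (λ k → k))      ≡⟨ *-distribˡ-+ 2 (P * P) (∑₁ P (λ k → k)) ⟩
    2 * (P * P) + 2 * ∑₁ P (λ k → k)  ≡⟨ cong (2 * (P * P) +_) (∑₁-id P) ⟩
    2 * (P * P) + P * suc P           ∎)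

corollary4p4 : (h : ℕ) → h ≥ 1 →
    Σ (List (ℕ × ℕ)) λ L →
      Unique L × ((p : ℕ × ℕ) → (p ∈ L) ⇔ InS h p) ×
      2 * length L ≡ 2 ^ (h ∸ 1) * (2 ^ (h ∸ 1) + 2 ∸ h)
corollary4p4 zero ()
corollary4p4 (suc d) _ =
  region lower upper (2 ^ d) ,
  region-unique lower upper (2 ^ d) ,
  (λ _ → ⇔.trans (∈-region⇔ lower upper (2 ^ d)) (⇔.sym (InS⇔InRegion d))) ,
  trans (cong (2 *_) (length-region lower upper (2 ^ d))) (∑₁-columnSizes d)
  where
  lower upper : ℕ → ℕ
  lower = minInternals d
  upper = 2 ^ d +_
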